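{- Let $d\ge2$ and let $B\in\mathbb Z^{d\times d}$ with $D=|\det B|\ge1$, whose columns span the simplicial full-dimensional cone $B\mathbb R^d_+$, and let $C$ be a number with $|B_{i,j}|\le C$ for all $i,j$. Let $\bar B\mathbb R^d_+$ be an arbitrary cone appearing in the recursive signed decomposition procedure of Barvinok's algorithm applied to $B\mathbb R^d_+$, and let $\bar B^*=-(\bar B^{ -1})^\top$ with columns $\bar{\mathbf b}^*_1,\dots,\bar{\mathbf b}^*_d$. Then for every $i$, $$\bigl\|\det\bar B\cdot\bar{\mathbf b}^*_i\bigr\|_\infty\le (d-1)!\,\bigl(d^{k(D)}C\bigr)^{d-1},\qquad\text{where } k(D)=\Bigl\lfloor 1+\frac{\log_2\log_2 D}{\log_2\frac{d}{d-1}}\Bigr\rfloor.$$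
   Context: Barvinok's signed decomposition procedure: given a simplicial full-dimensional cone spanned by the columns $\mathbf b_1,\dots,\mathbf b_d\in\mathbb Z^d$ of a matrix $B$ with $|\det B|>1$, one constructs a vector $\mathbf w\in\mathbb Z^d$ with $\mathbf w=\sum_i\alpha_i\mathbf b_i$ and $|\alpha_i|\le|\det B|^{ -1/d}\le1$, and decomposes the cone (with signs) into the cones spanned by $d$ vectors from $\{\mathbf b_1,\dots,\mathbf b_d,\mathbf w\}$; each resulting full-dimensional cone has $|\det|\le|\det B|^{(d-1)/d}$. This is applied recursively. It is a known result of Barvinok that the depth of the resulting decomposition tree is at most $k(D)$ when the initial cone has $|\det B|=D$. -}

module Defs where

open import Data.Nat as ℕ using (ℕ; zero; suc)
open import Data.Integer as ℤ using (ℤ; +_)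
open import Data.Rational as ℚ using (ℚ)
open import Data.Fin using (Fin; zero; suc; punchIn; _≟_)
open import Data.Product using (Σ; _×_; _,_)
open import Data.Sum using (_⊎_)
open import Relation.Nullary using (yes; no)
open import Relation.Binary.PropositionalEquality using (_≡_; _≢_)

-- Integer d×d matrices, A i j = entry in row i, column j.
Mat : ℕ → Set
Mat d = Fin d → Fin d → ℤ

QMat : ℕ → Set
QMat d = Fin d → Fin d → ℚ

sumℤ : ∀ {n} → (Fin n → ℤ) → ℤ
sumℤ {zero}  f = + 0
sumℤ {suc n} f = f zero ℤ.+ sumℤ (λ i → f (suc i))

sumℚ : ∀ {n} → (Fin n → ℚ) → ℚ
sumℚ {zero}  f = ℚ.0ℚ
sumℚ {suc n} f = f zero ℚ.+ sumℚ (λ i → f (suc i))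

sgn : ∀ {n} → Fin n → ℤ
sgn zero    = + 1
sgn (suc j) = ℤ.- sgn j

det : ∀ {n} → Mat n → ℤ
det {zero}  A = + 1
det {suc n} A = sumℤ (λ j → sgn j ℤ.* (A zero j ℤ.* det (λ r c → A (suc r) (punchIn j c))))

toℚ : ℤ → ℚ
toℚ z = z ℚ./ 1

powℚ : ℚ → ℕ → ℚ
powℚ q zero    = ℚ.1ℚ
powℚ q (suc n) = q ℚ.* powℚ q n

replaceCol : ∀ {d} → Mat d → Fin d → (Fin d → ℤ) → Mat d
replaceCol B j w r c with c ≟ j
... | yes _ = w r
... | no  _ = B r c

-- w = Σ_i α_i b_i (b_i = columns of B) with |α_i| ≤ |det B|^(-1/d),
-- the last condition written equivalently as |α_i|^d · |det B| ≤ 1.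
ValidW : ∀ {d} → Mat d → (Fin d → ℤ) → Set
ValidW {d} B w =
  Σ (Fin d → ℚ) λ α →
    (∀ r → toℚ (w r) ≡ sumℚ (λ i → toℚ (B r i) ℚ.* α i))
    × (∀ i → powℚ (ℚ.∣ α i ∣) d ℚ.* toℚ (+ ℤ.∣ det B ∣) ℚ.≤ ℚ.1ℚ)

-- A cone with |det| > 1 is decomposed
-- using a valid w into the cones obtained by replacing one generator by w;
-- only the full-dimensional ones (det ≠ 0) are kept.
data Appears {d : ℕ} (B : Mat d) : Mat d → Set where
  root : Appears B B
  step : ∀ {B̄} → Appears B B̄ → 1 ℕ.< ℤ.∣ det B̄ ∣ →
         (w : Fin d → ℤ) → ValidW B̄ w → (j : Fin d) →
         det (replaceCol B̄ j w) ≢ + 0 →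
         Appears B (replaceCol B̄ j w)

-- IsK d D k : k = k(D) = ⌊1 + log₂log₂ D / log₂(d/(d-1))⌋ for D ≥ 2,
-- expressed in integer arithmetic:  k = m+1 with
--   m ≤ x  ⟺  2^(d^m) ≤ D^((d-1)^m)   and   ¬(m+1 ≤ x) ⟺ D^((d-1)^(m+1)) < 2^(d^(m+1)),
-- where x = log₂log₂ D / log₂(d/(d-1)).  For D = 1 (no decomposition
-- step occurs) we use the convention k(1) = 0.
IsK : ℕ → ℕ → ℕ → Set
IsK d D k =
  (D ≡ 1 × k ≡ 0)
  ⊎ Σ ℕ λ m → k ≡ suc m × 2 ℕ.≤ D
      × 2 ℕ.^ (d ℕ.^ m) ℕ.≤ D ℕ.^ ((d ℕ.∸ 1) ℕ.^ m)
      × D ℕ.^ ((d ℕ.∸ 1) ℕ.^ suc m) ℕ.< 2 ℕ.^ (d ℕ.^ suc m)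

-- By Cramer's rule, det B̄ · (B̄⁻¹)ᵢⱼ is the determinant of B̄ with column i replaced by the unit vector eⱼ;
-- expanding along that column bounds it by (d-1)! E^(d-1) when the entries of B̄ are at most E.  So it
-- remains to bound the entries of every cone of the decomposition by d^k(D) C.  A step replaces a column
-- by w = B̄α with |αᵢ| ≤ 1, so entries grow by at most a factor d; and the new determinant is αⱼ det B̄
-- (Cramer again), so |det|^d ≤ |det B̄|^(d-1), whence |det B̄|^(d^t) ≤ D^((d-1)^t) after t steps.  A step
-- from B̄ is only taken when |det B̄| ≥ 2, which forces 2^(d^t) ≤ D^((d-1)^t), i.e. t < k(D).
module Submission where

open import Data.Bool using (true; false; if_then_else_)
open import Data.Empty using (⊥-elim)
open import Data.Fin using (Fin; zero; suc; punchIn; punchOut; inject₁; toℕ; _≟_)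
import Data.Fin.Properties as FinP
open import Data.Fin.Permutation.Components using (transpose)
open import Data.Integer as ℤ using (ℤ; +_; -[1+_])
import Data.Integer.Properties as ℤP
open import Data.Nat as ℕ using (ℕ; zero; suc; _!; z≤n; s≤s)
import Data.Nat.Coprimality as Coprimality
import Data.Nat.Properties as ℕP
import Data.Nat.Solver as ℕSolver
open import Data.Product using (_×_; _,_)
open import Data.Rational as ℚ using (ℚ; mkℚ; 0ℚ; 1ℚ)
import Data.Rational.Properties as ℚP
import Data.Rational.Solver as ℚSolver
import Data.Rational.Unnormalised as ℚᵘ
import Data.Rational.Unnormalised.Properties as ℚᵘP
open import Data.Sum using (_⊎_; inj₁; inj₂)
open import Function using (_∘_)
open import Relation.Binary.Definitions using (tri<; tri≈; tri>)
open import Relation.Binary.PropositionalEquality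
open import Relation.Nullary using (yes; no; does)
open import Relation.Nullary.Decidable using (dec-true; dec-false)

open import Defs

-- The embedding ℤ → ℚ and finite sums

coprime-1 : ∀ m → Coprimality.Coprime m 1
coprime-1 m = Coprimality.sym (Coprimality.1-coprimeTo m)

toℚ≡mkℚ : ∀ z → toℚ z ≡ mkℚ z 0 (coprime-1 ℤ.∣ z ∣)
toℚ≡mkℚ (+ n)    = ℚP.normalize-coprime (coprime-1 n)
toℚ≡mkℚ -[1+ n ] = cong ℚ.-_ (ℚP.normalize-coprime (coprime-1 (suc n)))

toℚᵘ-toℚ : ∀ z → ℚ.toℚᵘ (toℚ z) ≡ ℚᵘ.mkℚᵘ z 0
toℚᵘ-toℚ z rewrite toℚ≡mkℚ z = refl

toℚ-homo-+ : ∀ a b → toℚ (a ℤ.+ b) ≡ toℚ a ℚ.+ toℚ b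
toℚ-homo-+ a b = ℚP.toℚᵘ-injective (begin
  ℚ.toℚᵘ (toℚ (a ℤ.+ b))
    ≡⟨ toℚᵘ-toℚ (a ℤ.+ b) ⟩
  ℚᵘ.mkℚᵘ (a ℤ.+ b) 0
    ≈⟨ ℚᵘ.*≡* (cong (ℤ._* + 1) (sym (cong₂ ℤ._+_ (ℤP.*-identityʳ a) (ℤP.*-identityʳ b)))) ⟩
  ℚᵘ.mkℚᵘ a 0 ℚᵘ.+ ℚᵘ.mkℚᵘ b 0
    ≡⟨ sym (cong₂ ℚᵘ._+_ (toℚᵘ-toℚ a) (toℚᵘ-toℚ b)) ⟩
  ℚ.toℚᵘ (toℚ a) ℚᵘ.+ ℚ.toℚᵘ (toℚ b)
    ≈⟨ ℚᵘP.≃-sym (ℚP.toℚᵘ-homo-+ (toℚ a) (toℚ b)) ⟩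
  ℚ.toℚᵘ (toℚ a ℚ.+ toℚ b) ∎)
  where open ℚᵘP.≃-Reasoning

toℚ-homo-* : ∀ a b → toℚ (a ℤ.* b) ≡ toℚ a ℚ.* toℚ b
toℚ-homo-* a b = ℚP.toℚᵘ-injective (begin
  ℚ.toℚᵘ (toℚ (a ℤ.* b))                ≡⟨ toℚᵘ-toℚ (a ℤ.* b) ⟩
  ℚᵘ.mkℚᵘ a 0 ℚᵘ.* ℚᵘ.mkℚᵘ b 0          ≡⟨ sym (cong₂ ℚᵘ._*_ (toℚᵘ-toℚ a) (toℚᵘ-toℚ b)) ⟩
  ℚ.toℚᵘ (toℚ a) ℚᵘ.* ℚ.toℚᵘ (toℚ b)    ≈⟨ ℚᵘP.≃-sym (ℚP.toℚᵘ-homo-* (toℚ a) (toℚ b)) ⟩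
  ℚ.toℚᵘ (toℚ a ℚ.* toℚ b)              ∎)
  where open ℚᵘP.≃-Reasoning

toℚ-homo‿- : ∀ a → toℚ (ℤ.- a) ≡ ℚ.- toℚ a
toℚ-homo‿- a = ℚP.toℚᵘ-injective (begin
  ℚ.toℚᵘ (toℚ (ℤ.- a))    ≡⟨ toℚᵘ-toℚ (ℤ.- a) ⟩
  ℚᵘ.- ℚᵘ.mkℚᵘ a 0        ≡⟨ sym (cong ℚᵘ.-_ (toℚᵘ-toℚ a)) ⟩
  ℚᵘ.- ℚ.toℚᵘ (toℚ a)     ≈⟨ ℚᵘP.≃-sym (ℚP.toℚᵘ-homo‿- (toℚ a)) ⟩
  ℚ.toℚᵘ (ℚ.- toℚ a)      ∎)
  where open ℚᵘP.≃-Reasoning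

∣toℚ∣≡toℚ∣∣ : ∀ a → ℚ.∣ toℚ a ∣ ≡ toℚ (+ ℤ.∣ a ∣)
∣toℚ∣≡toℚ∣∣ a rewrite toℚ≡mkℚ a | toℚ≡mkℚ (+ ℤ.∣ a ∣) = refl

toℚ-mono-≤ : ∀ {a b} → a ℤ.≤ b → toℚ a ℚ.≤ toℚ b
toℚ-mono-≤ {a} {b} a≤b rewrite toℚ≡mkℚ a | toℚ≡mkℚ b =
  ℚ.*≤* (subst₂ ℤ._≤_ (sym (ℤP.*-identityʳ a)) (sym (ℤP.*-identityʳ b)) a≤b)

toℚ-cancel-≤ : ∀ {a b} → toℚ a ℚ.≤ toℚ b → a ℤ.≤ b
toℚ-cancel-≤ {a} {b} le rewrite toℚ≡mkℚ a | toℚ≡mkℚ b with le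
... | ℚ.*≤* a*1≤b*1 = subst₂ ℤ._≤_ (ℤP.*-identityʳ a) (ℤP.*-identityʳ b) a*1≤b*1

toℚ+-mono-≤ : ∀ {m n} → m ℕ.≤ n → toℚ (+ m) ℚ.≤ toℚ (+ n)
toℚ+-mono-≤ m≤n = toℚ-mono-≤ (ℤ.+≤+ m≤n)

toℚ+-cancel-≤ : ∀ {m n} → toℚ (+ m) ℚ.≤ toℚ (+ n) → m ℕ.≤ n
toℚ+-cancel-≤ le = ℤP.drop‿+≤+ (toℚ-cancel-≤ le)

toℚ-homo-sum : ∀ {n} (f : Fin n → ℤ) → toℚ (sumℤ f) ≡ sumℚ (λ i → toℚ (f i))
toℚ-homo-sum {zero}  f = refl
toℚ-homo-sum {suc n} f =
  trans (toℚ-homo-+ (f zero) _) (cong (toℚ (f zero) ℚ.+_) (toℚ-homo-sum (λ i → f (suc i))))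

sumℚ-cong : ∀ {n} {f g : Fin n → ℚ} → (∀ i → f i ≡ g i) → sumℚ f ≡ sumℚ g
sumℚ-cong {zero}  f≡g = refl
sumℚ-cong {suc n} f≡g = cong₂ ℚ._+_ (f≡g zero) (sumℚ-cong (λ i → f≡g (suc i)))

sumℚ-+ : ∀ {n} (f g : Fin n → ℚ) → sumℚ (λ i → f i ℚ.+ g i) ≡ sumℚ f ℚ.+ sumℚ g
sumℚ-+ {zero}  f g = refl
sumℚ-+ {suc n} f g rewrite sumℚ-+ (λ i → f (suc i)) (λ i → g (suc i)) =
  solve 4 (λ a b c d → (a :+ b) :+ (c :+ d) := (a :+ c) :+ (b :+ d)) refl
    (f zero) (g zero) (sumℚ (λ i → f (suc i))) (sumℚ (λ i → g (suc i)))
  where open ℚSolver.+-*-Solver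

sumℚ-*ˡ : ∀ {n} k (f : Fin n → ℚ) → sumℚ (λ i → k ℚ.* f i) ≡ k ℚ.* sumℚ f
sumℚ-*ˡ {zero}  k f = sym (ℚP.*-zeroʳ k)
sumℚ-*ˡ {suc n} k f rewrite sumℚ-*ˡ k (λ i → f (suc i)) = sym (ℚP.*-distribˡ-+ k (f zero) _)

sumℚ-neg : ∀ {n} (f : Fin n → ℚ) → sumℚ (λ i → ℚ.- f i) ≡ ℚ.- sumℚ f
sumℚ-neg {zero}  f = refl
sumℚ-neg {suc n} f rewrite sumℚ-neg (λ i → f (suc i)) = sym (ℚP.neg-distrib-+ (f zero) _)

sumℚ-zero : ∀ {n} (f : Fin n → ℚ) → (∀ i → f i ≡ 0ℚ) → sumℚ f ≡ 0ℚ
sumℚ-zero {zero}  f f≡0 = refl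
sumℚ-zero {suc n} f f≡0 rewrite f≡0 zero | sumℚ-zero (λ i → f (suc i)) (λ i → f≡0 (suc i)) = refl

sumℚ-single : ∀ {n} (f : Fin n → ℚ) k → (∀ i → i ≢ k → f i ≡ 0ℚ) → sumℚ f ≡ f k
sumℚ-single {suc n} f zero f≡0
  rewrite sumℚ-zero (λ i → f (suc i)) (λ i → f≡0 (suc i) λ ()) = ℚP.+-identityʳ (f zero)
sumℚ-single {suc n} f (suc k) f≡0
  rewrite f≡0 zero (λ ())
        | sumℚ-single (λ i → f (suc i)) k (λ i i≢k → f≡0 (suc i) (i≢k ∘ FinP.suc-injective)) =
  ℚP.+-identityˡ _

∣sumℚ∣≤ : ∀ {n} (f : Fin n → ℚ) E → (∀ i → ℚ.∣ f i ∣ ℚ.≤ toℚ (+ E)) →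
  ℚ.∣ sumℚ f ∣ ℚ.≤ toℚ (+ (n ℕ.* E))
∣sumℚ∣≤ {zero}  f E ∣f∣≤E = ℚP.≤-refl
∣sumℚ∣≤ {suc n} f E ∣f∣≤E = begin
  ℚ.∣ f zero ℚ.+ sumℚ (λ i → f (suc i)) ∣
    ≤⟨ ℚP.∣p+q∣≤∣p∣+∣q∣ (f zero) _ ⟩
  ℚ.∣ f zero ∣ ℚ.+ ℚ.∣ sumℚ (λ i → f (suc i)) ∣
    ≤⟨ ℚP.+-mono-≤ (∣f∣≤E zero) (∣sumℚ∣≤ (λ i → f (suc i)) E (λ i → ∣f∣≤E (suc i))) ⟩
  toℚ (+ E) ℚ.+ toℚ (+ (n ℕ.* E))
    ≡⟨ sym (toℚ-homo-+ (+ E) (+ (n ℕ.* E))) ⟩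
  toℚ (+ (suc n ℕ.* E)) ∎
  where open ℚP.≤-Reasoning

sumℕ : ∀ {n} → (Fin n → ℕ) → ℕ
sumℕ {zero}  f = 0
sumℕ {suc n} f = f zero ℕ.+ sumℕ (λ i → f (suc i))

sumℕ-cong : ∀ {n} {f g : Fin n → ℕ} → (∀ i → f i ≡ g i) → sumℕ f ≡ sumℕ g
sumℕ-cong {zero}  f≡g = refl
sumℕ-cong {suc n} f≡g = cong₂ ℕ._+_ (f≡g zero) (sumℕ-cong (λ i → f≡g (suc i)))

sumℕ-≤ : ∀ {n} (f : Fin n → ℕ) Y → (∀ i → f i ℕ.≤ Y) → sumℕ f ℕ.≤ n ℕ.* Y
sumℕ-≤ {zero}  f Y f≤Y = z≤n
sumℕ-≤ {suc n} f Y f≤Y = ℕP.+-mono-≤ (f≤Y zero) (sumℕ-≤ (λ i → f (suc i)) Y (λ i → f≤Y (suc i)))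

sumℕ-≤-except : ∀ {n} (f : Fin (suc n) → ℕ) p X Y → f p ℕ.≤ X → (∀ j → j ≢ p → f j ℕ.≤ Y) →
  sumℕ f ℕ.≤ X ℕ.+ n ℕ.* Y
sumℕ-≤-except f zero X Y fp≤X f≤Y =
  ℕP.+-mono-≤ fp≤X (sumℕ-≤ (λ i → f (suc i)) Y (λ i → f≤Y (suc i) λ ()))
sumℕ-≤-except {suc n} f (suc p) X Y fp≤X f≤Y = begin
  f zero ℕ.+ sumℕ (λ i → f (suc i))
    ≤⟨ ℕP.+-mono-≤ (f≤Y zero λ ()) (sumℕ-≤-except (λ i → f (suc i)) p X Y fp≤X
                                       (λ j j≢p → f≤Y (suc j) (j≢p ∘ FinP.suc-injective))) ⟩
  Y ℕ.+ (X ℕ.+ n ℕ.* Y)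
    ≡⟨ solve 3 (λ X Y n → Y :+ (X :+ n :* Y) := X :+ (con 1 :+ n) :* Y) refl X Y n ⟩
  X ℕ.+ suc n ℕ.* Y ∎
  where
  open ℕP.≤-Reasoning
  open ℕSolver.+-*-Solver

∣sumℤ∣≤sumℕ∣∣ : ∀ {n} (f : Fin n → ℤ) → ℤ.∣ sumℤ f ∣ ℕ.≤ sumℕ (λ i → ℤ.∣ f i ∣)
∣sumℤ∣≤sumℕ∣∣ {zero}  f = z≤n
∣sumℤ∣≤sumℕ∣∣ {suc n} f = ℕP.≤-trans (ℤP.∣i+j∣≤∣i∣+∣j∣ (f zero) _)
  (ℕP.+-monoʳ-≤ ℤ.∣ f zero ∣ (∣sumℤ∣≤sumℕ∣∣ (λ i → f (suc i))))

-- Determinants over ℚ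

minor : ∀ {n} {A : Set} → (Fin (suc n) → Fin (suc n) → A) → Fin (suc n) → Fin n → Fin n → A
minor M j r c = M (suc r) (punchIn j c)

detℚ : ∀ {n} → QMat n → ℚ
detℚ {zero}  A = 1ℚ
detℚ {suc n} A = sumℚ (λ j → toℚ (sgn j) ℚ.* (A zero j ℚ.* detℚ (minor A j)))

laplaceTerm : ∀ {n} → QMat (suc n) → Fin (suc n) → ℚ
laplaceTerm A j = toℚ (sgn j) ℚ.* (A zero j ℚ.* detℚ (minor A j))

toℚᴹ : ∀ {n} → Mat n → QMat n
toℚᴹ A r c = toℚ (A r c)

toℚ-det : ∀ {n} (A : Mat n) → toℚ (det A) ≡ detℚ (toℚᴹ A)
toℚ-det {zero}  A = refl
toℚ-det {suc n} A =
  trans (toℚ-homo-sum (λ j → sgn j ℤ.* (A zero j ℤ.* det (minor A j)))) (sumℚ-cong λ j → begin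
    toℚ (sgn j ℤ.* (A zero j ℤ.* det (minor A j)))
      ≡⟨ toℚ-homo-* (sgn j) _ ⟩
    toℚ (sgn j) ℚ.* toℚ (A zero j ℤ.* det (minor A j))
      ≡⟨ cong (toℚ (sgn j) ℚ.*_) (toℚ-homo-* (A zero j) _) ⟩
    toℚ (sgn j) ℚ.* (toℚ (A zero j) ℚ.* toℚ (det (minor A j)))
      ≡⟨ cong (λ x → toℚ (sgn j) ℚ.* (toℚ (A zero j) ℚ.* x)) (toℚ-det (minor A j)) ⟩
    laplaceTerm (toℚᴹ A) j ∎)
  where open ≡-Reasoning

detℚ-cong : ∀ {n} {A A' : QMat n} → (∀ r c → A r c ≡ A' r c) → detℚ A ≡ detℚ A'
detℚ-cong {zero}  A≡A' = refl
detℚ-cong {suc n} A≡A' = sumℚ-cong λ j →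
  cong₂ (λ a m → toℚ (sgn j) ℚ.* (a ℚ.* m)) (A≡A' zero j) (detℚ-cong (λ r c → A≡A' (suc r) (punchIn j c)))

SameOffColumn : ∀ {n} → Fin n → QMat n → QMat n → Set
SameOffColumn i A A' = ∀ r c → c ≢ i → A' r c ≡ A r c

punchIn≢ : ∀ {n} {j i : Fin (suc n)} (j≢i : j ≢ i) c → c ≢ punchOut j≢i → punchIn j c ≢ i
punchIn≢ {j = j} j≢i c c≢ eq =
  c≢ (FinP.punchIn-injective j c (punchOut j≢i) (trans eq (sym (FinP.punchIn-punchOut j≢i))))

minor-sameOffColumn : ∀ {n} {A A' : QMat (suc n)} {i j} → SameOffColumn i A A' →
  (j≢i : j ≢ i) → SameOffColumn (punchOut j≢i) (minor A j) (minor A' j)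
minor-sameOffColumn {j = j} same j≢i r c c≢ = same (suc r) (punchIn j c) (punchIn≢ j≢i c c≢)

minor-sameOffColumn-at : ∀ {n} {A A' : QMat (suc n)} {i} → SameOffColumn i A A' →
  ∀ r c → minor A' i r c ≡ minor A i r c
minor-sameOffColumn-at {i = i} same r c = same (suc r) (punchIn i c) (FinP.punchInᵢ≢i i c)

minor-column : ∀ {n} {X : Set} (A : Fin (suc n) → Fin (suc n) → X) {i j} (j≢i : j ≢ i) r →
  minor A j r (punchOut j≢i) ≡ A (suc r) i
minor-column A j≢i r = cong (A (suc r)) (FinP.punchIn-punchOut j≢i)

detℚ-additive : ∀ {n} (A A' A'' : QMat n) i → SameOffColumn i A A' → SameOffColumn i A A'' →
  (∀ r → A'' r i ≡ A r i ℚ.+ A' r i) → detℚ A'' ≡ detℚ A ℚ.+ detℚ A'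
detℚ-additive {suc n} A A' A'' i same' same'' column =
  trans (sumℚ-cong term) (sumℚ-+ (laplaceTerm A) (laplaceTerm A'))
  where
  open ℚSolver.+-*-Solver
  open ≡-Reasoning
  column-minor : ∀ {j} (j≢i : j ≢ i) r →
    minor A'' j r (punchOut j≢i) ≡ minor A j r (punchOut j≢i) ℚ.+ minor A' j r (punchOut j≢i)
  column-minor {j} j≢i r = begin
    minor A'' j r (punchOut j≢i)
      ≡⟨ minor-column A'' j≢i r ⟩
    A'' (suc r) i
      ≡⟨ column (suc r) ⟩
    A (suc r) i ℚ.+ A' (suc r) i
      ≡⟨ sym (cong₂ ℚ._+_ (minor-column A j≢i r) (minor-column A' j≢i r)) ⟩
    minor A j r (punchOut j≢i) ℚ.+ minor A' j r (punchOut j≢i) ∎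
  term : ∀ j → laplaceTerm A'' j ≡ laplaceTerm A j ℚ.+ laplaceTerm A' j
  term j with j ≟ i
  ... | yes refl
    rewrite column zero
          | detℚ-cong (minor-sameOffColumn-at same'')
          | detℚ-cong (minor-sameOffColumn-at same') =
    solve 4 (λ s a a' m → s :* ((a :+ a') :* m) := s :* (a :* m) :+ s :* (a' :* m)) refl
      (toℚ (sgn j)) (A zero j) (A' zero j) (detℚ (minor A j))
  ... | no j≢i
    rewrite same'' zero j j≢i | same' zero j j≢i
          | detℚ-additive (minor A j) (minor A' j) (minor A'' j) (punchOut j≢i)
              (minor-sameOffColumn same' j≢i) (minor-sameOffColumn same'' j≢i) (column-minor j≢i) =
    solve 4 (λ s a m m' → s :* (a :* (m :+ m')) := s :* (a :* m) :+ s :* (a :* m')) refl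
      (toℚ (sgn j)) (A zero j) (detℚ (minor A j)) (detℚ (minor A' j))

detℚ-homogeneous : ∀ {n} (A A' : QMat n) i k → SameOffColumn i A A' →
  (∀ r → A' r i ≡ k ℚ.* A r i) → detℚ A' ≡ k ℚ.* detℚ A
detℚ-homogeneous {suc n} A A' i k same column = trans (sumℚ-cong term) (sumℚ-*ˡ k (laplaceTerm A))
  where
  open ℚSolver.+-*-Solver
  open ≡-Reasoning
  column-minor : ∀ {j} (j≢i : j ≢ i) r → minor A' j r (punchOut j≢i) ≡ k ℚ.* minor A j r (punchOut j≢i)
  column-minor {j} j≢i r = begin
    minor A' j r (punchOut j≢i)        ≡⟨ minor-column A' j≢i r ⟩
    A' (suc r) i                       ≡⟨ column (suc r) ⟩
    k ℚ.* A (suc r) i                  ≡⟨ cong (k ℚ.*_) (sym (minor-column A j≢i r)) ⟩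
    k ℚ.* minor A j r (punchOut j≢i)   ∎
  term : ∀ j → laplaceTerm A' j ≡ k ℚ.* laplaceTerm A j
  term j with j ≟ i
  ... | yes refl rewrite column zero | detℚ-cong (minor-sameOffColumn-at same) =
    solve 4 (λ s k a m → s :* ((k :* a) :* m) := k :* (s :* (a :* m))) refl
      (toℚ (sgn j)) k (A zero j) (detℚ (minor A j))
  ... | no j≢i
    rewrite same zero j j≢i
          | detℚ-homogeneous (minor A j) (minor A' j) (punchOut j≢i) k
              (minor-sameOffColumn same j≢i) (column-minor j≢i) =
    solve 4 (λ s k a m → s :* (a :* (k :* m)) := k :* (s :* (a :* m))) refl
      (toℚ (sgn j)) k (A zero j) (detℚ (minor A j))

data Adjacent : ∀ {n} → Fin n → Fin n → Set where
  here  : ∀ {n} → Adjacent {suc (suc n)} zero (suc zero)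
  there : ∀ {n} {a b : Fin n} → Adjacent a b → Adjacent (suc a) (suc b)

adjacent-inject₁ : ∀ {n} (x : Fin (suc n)) → Adjacent (inject₁ x) (suc x)
adjacent-inject₁         zero    = here
adjacent-inject₁ {suc n} (suc x) = there (adjacent-inject₁ x)

sgn-adjacent : ∀ {n} {a b : Fin n} → Adjacent a b → sgn b ≡ ℤ.- sgn a
sgn-adjacent here      = refl
sgn-adjacent (there p) = cong ℤ.-_ (sgn-adjacent p)

punchIn-adjacent : ∀ {n} {a b : Fin (suc n)} → Adjacent a b → ∀ c →
  (punchIn a c ≡ b × punchIn b c ≡ a) ⊎ (punchIn a c ≡ punchIn b c × punchIn a c ≢ b)
punchIn-adjacent here      zero    = inj₁ (refl , refl)
punchIn-adjacent here      (suc c) = inj₂ (refl , λ ())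
punchIn-adjacent (there p) zero    = inj₂ (refl , λ ())
punchIn-adjacent (there p) (suc c) with punchIn-adjacent p c
... | inj₁ (a↦b , b↦a) = inj₁ (cong suc a↦b , cong suc b↦a)
... | inj₂ (a≡b , a≢b) = inj₂ (cong suc a≡b , a≢b ∘ FinP.suc-injective)

punchOut-adjacent : ∀ {n} {j a b : Fin (suc n)} (j≢a : j ≢ a) (j≢b : j ≢ b) →
  Adjacent a b → Adjacent (punchOut j≢a) (punchOut j≢b)
punchOut-adjacent {j = zero}     j≢a j≢b here = ⊥-elim (j≢a refl)
punchOut-adjacent {j = suc zero} j≢a j≢b here = ⊥-elim (j≢b refl)
punchOut-adjacent {suc (suc n)} {j = suc (suc j)} j≢a j≢b here = here
punchOut-adjacent {j = zero} j≢a j≢b (there p) = p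
punchOut-adjacent {suc n} {j = suc j} j≢a j≢b (there p) =
  there (punchOut-adjacent (j≢a ∘ cong suc) (j≢b ∘ cong suc) p)

sumℚ-swap-adjacent : ∀ {n} (f g : Fin n → ℚ) {a b} → Adjacent a b → f a ≡ g b → f b ≡ g a →
  (∀ j → j ≢ a → j ≢ b → f j ≡ g j) → sumℚ f ≡ sumℚ g
sumℚ-swap-adjacent f g here fa≡gb fb≡ga rest
  rewrite fa≡gb | fb≡ga
        | sumℚ-cong {f = λ i → f (suc (suc i))} (λ i → rest (suc (suc i)) (λ ()) (λ ())) =
  solve 3 (λ x y z → x :+ (y :+ z) := y :+ (x :+ z)) refl (g (suc zero)) (g zero) _
  where open ℚSolver.+-*-Solver
sumℚ-swap-adjacent f g (there p) fa≡gb fb≡ga rest rewrite rest zero (λ ()) (λ ()) =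
  cong (g zero ℚ.+_) (sumℚ-swap-adjacent (λ i → f (suc i)) (λ i → g (suc i)) p fa≡gb fb≡ga
    (λ j j≢a j≢b → rest (suc j) (j≢a ∘ FinP.suc-injective) (j≢b ∘ FinP.suc-injective)))

SwapsColumns : ∀ {n} → Fin n → Fin n → QMat n → QMat n → Set
SwapsColumns a b A A' =
  (∀ r → A' r a ≡ A r b) × (∀ r → A' r b ≡ A r a) × (∀ r c → c ≢ a → c ≢ b → A' r c ≡ A r c)

detℚ-swap-adjacent : ∀ {n} (A A' : QMat n) {a b} → Adjacent a b → SwapsColumns a b A A' →
  detℚ A' ≡ ℚ.- detℚ A
detℚ-swap-adjacent {suc n} A A' {a} {b} ab (A'a , A'b , A'c) =
  trans (sumℚ-swap-adjacent (laplaceTerm A') (λ j → ℚ.- laplaceTerm A j) ab term-a term-b term-other)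
        (sumℚ-neg (laplaceTerm A))
  where
  open ℚSolver.+-*-Solver
  minor-a : ∀ r c → minor A' a r c ≡ minor A b r c
  minor-a r c with punchIn-adjacent ab c
  ... | inj₁ (a↦b , b↦a) rewrite a↦b | b↦a = A'b (suc r)
  ... | inj₂ (a≡b , a≢b) =
    trans (A'c (suc r) (punchIn a c) (FinP.punchInᵢ≢i a c) a≢b) (cong (A (suc r)) a≡b)
  minor-b : ∀ r c → minor A' b r c ≡ minor A a r c
  minor-b r c with punchIn-adjacent ab c
  ... | inj₁ (a↦b , b↦a) rewrite a↦b | b↦a = A'a (suc r)
  ... | inj₂ (a≡b , a≢b) rewrite sym a≡b = A'c (suc r) (punchIn a c) (FinP.punchInᵢ≢i a c) a≢b
  term-a : laplaceTerm A' a ≡ ℚ.- laplaceTerm A b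
  term-a rewrite A'a zero | detℚ-cong minor-a | sgn-adjacent ab | toℚ-homo‿- (sgn a) =
    solve 3 (λ s x m → s :* (x :* m) := :- ((:- s) :* (x :* m))) refl
      (toℚ (sgn a)) (A zero b) (detℚ (minor A b))
  term-b : laplaceTerm A' b ≡ ℚ.- laplaceTerm A a
  term-b rewrite A'b zero | detℚ-cong minor-b | sgn-adjacent ab | toℚ-homo‿- (sgn a) =
    solve 3 (λ s x m → (:- s) :* (x :* m) := :- (s :* (x :* m))) refl
      (toℚ (sgn a)) (A zero a) (detℚ (minor A a))
  term-other : ∀ j → j ≢ a → j ≢ b → laplaceTerm A' j ≡ ℚ.- laplaceTerm A j
  term-other j j≢a j≢b
    rewrite A'c zero j j≢a j≢b
          | detℚ-swap-adjacent (minor A j) (minor A' j) (punchOut-adjacent j≢a j≢b ab)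
              ( (λ r → trans (minor-column A' j≢a r) (trans (A'a (suc r)) (sym (minor-column A j≢b r))))
              , (λ r → trans (minor-column A' j≢b r) (trans (A'b (suc r)) (sym (minor-column A j≢a r))))
              , (λ r c c≢a c≢b → A'c (suc r) (punchIn j c) (punchIn≢ j≢a c c≢a) (punchIn≢ j≢b c c≢b))) =
    solve 3 (λ s x m → s :* (x :* (:- m)) := :- (s :* (x :* m))) refl
      (toℚ (sgn j)) (A zero j) (detℚ (minor A j))

x≡-x⇒x≡0 : ∀ x → x ≡ ℚ.- x → x ≡ 0ℚ
x≡-x⇒x≡0 x x≡-x = begin
  x                    ≡⟨ solve 1 (λ x → x := con ℚ.½ :* (x :+ x)) refl x ⟩
  ℚ.½ ℚ.* (x ℚ.+ x)    ≡⟨ cong (λ y → ℚ.½ ℚ.* (x ℚ.+ y)) x≡-x ⟩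
  ℚ.½ ℚ.* (x ℚ.- x)    ≡⟨ cong (ℚ.½ ℚ.*_) (ℚP.+-inverseʳ x) ⟩
  ℚ.½ ℚ.* 0ℚ           ≡⟨ ℚP.*-zeroʳ ℚ.½ ⟩
  0ℚ                   ∎
  where
  open ℚSolver.+-*-Solver
  open ≡-Reasoning

transpose-matchˡ : ∀ {n} (i j : Fin n) → transpose i j i ≡ j
transpose-matchˡ i j rewrite dec-true (i ≟ i) refl = refl

transpose-matchʳ : ∀ {n} {i j : Fin n} → i ≢ j → transpose i j j ≡ i
transpose-matchʳ {i = i} {j} i≢j rewrite dec-false (j ≟ i) (i≢j ∘ sym) | dec-true (j ≟ j) refl = refl

transpose-other : ∀ {n} {i j k : Fin n} → k ≢ i → k ≢ j → transpose i j k ≡ k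
transpose-other {i = i} {j} {k} k≢i k≢j rewrite dec-false (k ≟ i) k≢i | dec-false (k ≟ j) k≢j = refl

-- Swapping the adjacent columns q - 1 and q negates detℚ and moves the copy of column p one step closer;
-- once the equal columns are adjacent, that swap fixes A, so detℚ A = - detℚ A.
detℚ-equal-columns-gap : ∀ g {n} (A : QMat n) p q → toℕ q ≡ g ℕ.+ suc (toℕ p) →
  (∀ r → A r p ≡ A r q) → detℚ A ≡ 0ℚ
detℚ-equal-columns-gap g A p zero gap equal = ⊥-elim (ℕP.m+1+n≢0 g (sym gap))
detℚ-equal-columns-gap g {suc zero} A p (suc ()) gap equal
detℚ-equal-columns-gap zero {suc (suc n)} A p (suc x) gap equal
  with refl ← FinP.toℕ-injective (trans (FinP.toℕ-inject₁ x) (ℕP.suc-injective gap)) =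
  x≡-x⇒x≡0 (detℚ A) (detℚ-swap-adjacent A A (adjacent-inject₁ x) (equal , sym ∘ equal , λ _ _ _ _ → refl))
detℚ-equal-columns-gap (suc g) {suc (suc n)} A p (suc x) gap equal =
  ℚP.neg-injective (trans (sym (detℚ-swap-adjacent A A' (adjacent-inject₁ x) swaps))
    (detℚ-equal-columns-gap g A' p (inject₁ x) (trans (FinP.toℕ-inject₁ x) (ℕP.suc-injective gap)) equal'))
  where
  A' : QMat (suc (suc n))
  A' r c = A r (transpose (inject₁ x) (suc x) c)
  x<suc-x : toℕ (inject₁ x) ℕ.< toℕ (suc x)
  x<suc-x = s≤s (ℕP.≤-reflexive (FinP.toℕ-inject₁ x))
  p<x : toℕ p ℕ.< toℕ (inject₁ x)
  p<x = ℕP.≤-trans (ℕP.m≤n+m (suc (toℕ p)) g)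
          (ℕP.≤-reflexive (sym (trans (FinP.toℕ-inject₁ x) (ℕP.suc-injective gap))))
  distinct : ∀ {u v : Fin (suc (suc n))} → toℕ u ℕ.< toℕ v → u ≢ v
  distinct u<v refl = ℕP.<-irrefl refl u<v
  swaps : SwapsColumns (inject₁ x) (suc x) A A'
  swaps = (λ r → cong (A r) (transpose-matchˡ (inject₁ x) (suc x)))
        , (λ r → cong (A r) (transpose-matchʳ (distinct x<suc-x)))
        , λ r c c≢x c≢sx → cong (A r) (transpose-other c≢x c≢sx)
  equal' : ∀ r → A' r p ≡ A' r (inject₁ x)
  equal' r = trans (cong (A r) (transpose-other (distinct p<x) (distinct (ℕP.<-trans p<x x<suc-x))))
                   (trans (equal r) (sym (cong (A r) (transpose-matchˡ (inject₁ x) (suc x)))))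

detℚ-equal-columns : ∀ {n} (A : QMat n) {p q} → p ≢ q → (∀ r → A r p ≡ A r q) → detℚ A ≡ 0ℚ
detℚ-equal-columns A {p} {q} p≢q equal with ℕP.<-cmp (toℕ p) (toℕ q)
... | tri< p<q _ _ = detℚ-equal-columns-gap _ A p q (sym (ℕP.m∸n+n≡m p<q)) equal
... | tri≈ _ p≡q _ = ⊥-elim (p≢q (FinP.toℕ-injective p≡q))
... | tri> _ _ q<p = detℚ-equal-columns-gap _ A q p (sym (ℕP.m∸n+n≡m q<p)) (sym ∘ equal)

setColumn : ∀ {n} → QMat n → Fin n → (Fin n → ℚ) → QMat n
setColumn A i v r c = if does (c ≟ i) then v r else A r c

setColumn-at : ∀ {n} (A : QMat n) i v r → setColumn A i v r i ≡ v r
setColumn-at A i v r rewrite dec-true (i ≟ i) refl = refl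

setColumn-sameOffColumn : ∀ {n} (A : QMat n) i v → SameOffColumn i A (setColumn A i v)
setColumn-sameOffColumn A i v r c c≢i rewrite dec-false (c ≟ i) c≢i = refl

detℚ-sum-in-column : ∀ {n} m (v : Fin m → Fin n → ℚ) (A A' : QMat n) i → SameOffColumn i A A' →
  (∀ r → A' r i ≡ sumℚ (λ l → v l r)) → detℚ A' ≡ sumℚ (λ l → detℚ (setColumn A i (v l)))
detℚ-sum-in-column zero v A A' i same column = begin
  detℚ A'
    ≡⟨ detℚ-homogeneous A' A' i 0ℚ (λ _ _ _ → refl) (λ r → trans (column r) (sym (ℚP.*-zeroˡ (A' r i)))) ⟩
  0ℚ ℚ.* detℚ A'
    ≡⟨ ℚP.*-zeroˡ (detℚ A') ⟩
  0ℚ ∎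
  where open ≡-Reasoning
detℚ-sum-in-column (suc m) v A A' i same column = begin
  detℚ A'
    ≡⟨ detℚ-additive Head Tail A' i same-tail same-A' column' ⟩
  detℚ Head ℚ.+ detℚ Tail
    ≡⟨ cong (detℚ Head ℚ.+_) (detℚ-sum-in-column m (λ l → v (suc l)) A Tail i
         (setColumn-sameOffColumn A i tailSum) (setColumn-at A i tailSum)) ⟩
  detℚ Head ℚ.+ sumℚ (λ l → detℚ (setColumn A i (v (suc l)))) ∎
  where
  open ≡-Reasoning
  tailSum : Fin _ → ℚ
  tailSum r = sumℚ (λ l → v (suc l) r)
  Head Tail : QMat _
  Head = setColumn A i (v zero)
  Tail = setColumn A i tailSum
  same-tail : SameOffColumn i Head Tail
  same-tail r c c≢i =
    trans (setColumn-sameOffColumn A i tailSum r c c≢i) (sym (setColumn-sameOffColumn A i (v zero) r c c≢i))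
  same-A' : SameOffColumn i Head A'
  same-A' r c c≢i = trans (same r c c≢i) (sym (setColumn-sameOffColumn A i (v zero) r c c≢i))
  column' : ∀ r → A' r i ≡ Head r i ℚ.+ Tail r i
  column' r = trans (column r) (sym (cong₂ ℚ._+_ (setColumn-at A i (v zero) r) (setColumn-at A i tailSum r)))

cramer : ∀ {n} (A A' : QMat n) i (x : Fin n → ℚ) → SameOffColumn i A A' →
  (∀ r → A' r i ≡ sumℚ (λ l → A r l ℚ.* x l)) → detℚ A' ≡ x i ℚ.* detℚ A
cramer {n} A A' i x same column = begin
  detℚ A'                                              ≡⟨ detℚ-sum-in-column n scaledColumn A A' i same column ⟩
  sumℚ (λ l → detℚ (setColumn A i (scaledColumn l)))   ≡⟨ sumℚ-single _ i vanish ⟩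
  detℚ (setColumn A i (scaledColumn i))                ≡⟨ scaled i ⟩
  x i ℚ.* detℚ (setColumn A i (columnOf i))            ≡⟨ cong (x i ℚ.*_) (detℚ-cong unchanged) ⟩
  x i ℚ.* detℚ A                                       ∎
  where
  open ≡-Reasoning
  columnOf scaledColumn : Fin n → Fin n → ℚ
  columnOf l r = A r l
  scaledColumn l r = A r l ℚ.* x l
  scaled : ∀ l → detℚ (setColumn A i (scaledColumn l)) ≡ x l ℚ.* detℚ (setColumn A i (columnOf l))
  scaled l = detℚ-homogeneous (setColumn A i (columnOf l)) (setColumn A i (scaledColumn l)) i (x l)
    (λ r c c≢i → trans (setColumn-sameOffColumn A i (scaledColumn l) r c c≢i)
                       (sym (setColumn-sameOffColumn A i (columnOf l) r c c≢i)))
    (λ r → trans (setColumn-at A i (scaledColumn l) r)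
                 (trans (ℚP.*-comm (A r l) (x l)) (cong (x l ℚ.*_) (sym (setColumn-at A i (columnOf l) r)))))
  vanish : ∀ l → l ≢ i → detℚ (setColumn A i (scaledColumn l)) ≡ 0ℚ
  vanish l l≢i = begin
    detℚ (setColumn A i (scaledColumn l))
      ≡⟨ scaled l ⟩
    x l ℚ.* detℚ (setColumn A i (columnOf l))
      ≡⟨ cong (x l ℚ.*_) (detℚ-equal-columns _ (l≢i ∘ sym) (λ r →
           trans (setColumn-at A i (columnOf l) r) (sym (setColumn-sameOffColumn A i (columnOf l) r l l≢i)))) ⟩
    x l ℚ.* 0ℚ
      ≡⟨ ℚP.*-zeroʳ (x l) ⟩
    0ℚ ∎
  unchanged : ∀ r c → setColumn A i (columnOf i) r c ≡ A r c
  unchanged r c with c ≟ i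
  ... | yes refl = refl
  ... | no _     = refl

replaceCol-at : ∀ {d} (B : Mat d) j w r → replaceCol B j w r j ≡ w r
replaceCol-at B j w r with j ≟ j
... | yes _   = refl
... | no j≢j = ⊥-elim (j≢j refl)

replaceCol-off : ∀ {d} (B : Mat d) j w r c → c ≢ j → replaceCol B j w r c ≡ B r c
replaceCol-off B j w r c c≢j with c ≟ j
... | yes c≡j = ⊥-elim (c≢j c≡j)
... | no _    = refl

toℚ-det-replaceCol : ∀ {n} (B : Mat n) j w (α : Fin n → ℚ) →
  (∀ r → toℚ (w r) ≡ sumℚ (λ i → toℚ (B r i) ℚ.* α i)) →
  toℚ (det (replaceCol B j w)) ≡ α j ℚ.* toℚ (det B)
toℚ-det-replaceCol B j w α w≡Bα = begin
  toℚ (det (replaceCol B j w))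
    ≡⟨ toℚ-det (replaceCol B j w) ⟩
  detℚ (toℚᴹ (replaceCol B j w))
    ≡⟨ cramer (toℚᴹ B) (toℚᴹ (replaceCol B j w)) j α
         (λ r c c≢j → cong toℚ (replaceCol-off B j w r c c≢j))
         (λ r → trans (cong toℚ (replaceCol-at B j w r)) (w≡Bα r)) ⟩
  α j ℚ.* detℚ (toℚᴹ B)
    ≡⟨ cong (α j ℚ.*_) (sym (toℚ-det B)) ⟩
  α j ℚ.* toℚ (det B) ∎
  where open ≡-Reasoning

-- Size of integer determinants

∣sgn∣≡1 : ∀ {n} (j : Fin n) → ℤ.∣ sgn j ∣ ≡ 1
∣sgn∣≡1 zero    = refl
∣sgn∣≡1 (suc j) = trans (ℤP.∣-i∣≡∣i∣ (sgn j)) (∣sgn∣≡1 j)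

∣det∣≤laplace : ∀ {n} (A : Mat (suc n)) →
  ℤ.∣ det A ∣ ℕ.≤ sumℕ (λ j → ℤ.∣ A zero j ∣ ℕ.* ℤ.∣ det (minor A j) ∣)
∣det∣≤laplace A = ℕP.≤-trans (∣sumℤ∣≤sumℕ∣∣ (λ j → sgn j ℤ.* (A zero j ℤ.* det (minor A j))))
  (ℕP.≤-reflexive (sumℕ-cong λ j → begin
    ℤ.∣ sgn j ℤ.* (A zero j ℤ.* det (minor A j)) ∣        ≡⟨ ℤP.abs-* (sgn j) _ ⟩
    ℤ.∣ sgn j ∣ ℕ.* ℤ.∣ A zero j ℤ.* det (minor A j) ∣    ≡⟨ cong₂ ℕ._*_ (∣sgn∣≡1 j) (ℤP.abs-* (A zero j) _) ⟩
    1 ℕ.* (ℤ.∣ A zero j ∣ ℕ.* ℤ.∣ det (minor A j) ∣)      ≡⟨ ℕP.*-identityˡ _ ⟩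
    ℤ.∣ A zero j ∣ ℕ.* ℤ.∣ det (minor A j) ∣              ∎))
  where open ≡-Reasoning

∣det∣≤column-norm : ∀ n (A : Mat (suc n)) p E → (∀ r c → c ≢ p → ℤ.∣ A r c ∣ ℕ.≤ E) →
  ℤ.∣ det A ∣ ℕ.≤ sumℕ (λ r → ℤ.∣ A r p ∣) ℕ.* ((n !) ℕ.* E ℕ.^ n)
∣det∣≤column-norm zero A zero E _ = ℕP.≤-trans (∣det∣≤laplace A) (ℕP.≤-reflexive
  (solve 1 (λ a → a :* con 1 :+ con 0 := (a :+ con 0) :* (con 1 :* con 1)) refl ℤ.∣ A zero zero ∣))
  where open ℕSolver.+-*-Solver
∣det∣≤column-norm (suc m) A p E bounded = begin
  ℤ.∣ det A ∣
    ≤⟨ ∣det∣≤laplace A ⟩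
  sumℕ (λ j → ℤ.∣ A zero j ∣ ℕ.* ℤ.∣ det (minor A j) ∣)
    ≤⟨ sumℕ-≤-except _ p _ _ (ℕP.*-monoʳ-≤ ℤ.∣ A zero p ∣ term-p) term-other ⟩
  ℤ.∣ A zero p ∣ ℕ.* ((suc m ℕ.* E) ℕ.* F) ℕ.+ suc m ℕ.* (E ℕ.* (S ℕ.* F))
    ≡⟨ solve 5 (λ a S m E F → a :* (((con 1 :+ m) :* E) :* F) :+ (con 1 :+ m) :* (E :* (S :* F))
                              := (a :+ S) :* (((con 1 :+ m) :* E) :* F)) refl ℤ.∣ A zero p ∣ S m E F ⟩
  (ℤ.∣ A zero p ∣ ℕ.+ S) ℕ.* ((suc m ℕ.* E) ℕ.* F)
    ≡⟨ cong ((ℤ.∣ A zero p ∣ ℕ.+ S) ℕ.*_) (solve 4 (λ m E f P → ((con 1 :+ m) :* E) :* (f :* P)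
                                                := ((con 1 :+ m) :* f) :* (E :* P)) refl m E (m !) (E ℕ.^ m)) ⟩
  (ℤ.∣ A zero p ∣ ℕ.+ S) ℕ.* ((suc m !) ℕ.* E ℕ.^ suc m) ∎
  where
  open ℕP.≤-Reasoning
  open ℕSolver.+-*-Solver
  F S : ℕ
  F = (m !) ℕ.* E ℕ.^ m
  S = sumℕ (λ r → ℤ.∣ A (suc r) p ∣)
  term-p : ℤ.∣ det (minor A p) ∣ ℕ.≤ (suc m ℕ.* E) ℕ.* F
  term-p = ℕP.≤-trans
    (∣det∣≤column-norm m (minor A p) zero E (λ r c _ → bounded (suc r) (punchIn p c) (FinP.punchInᵢ≢i p c)))
    (ℕP.*-monoˡ-≤ F (sumℕ-≤ _ E (λ r → bounded (suc r) (punchIn p zero) (FinP.punchInᵢ≢i p zero))))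
  term-other : ∀ j → j ≢ p → ℤ.∣ A zero j ∣ ℕ.* ℤ.∣ det (minor A j) ∣ ℕ.≤ E ℕ.* (S ℕ.* F)
  term-other j j≢p = ℕP.*-mono-≤ (bounded zero j j≢p) (begin
    ℤ.∣ det (minor A j) ∣
      ≤⟨ ∣det∣≤column-norm m (minor A j) (punchOut j≢p) E
           (λ r c c≢ → bounded (suc r) (punchIn j c) (punchIn≢ j≢p c c≢)) ⟩
    sumℕ (λ r → ℤ.∣ minor A j r (punchOut j≢p) ∣) ℕ.* F
      ≡⟨ cong (ℕ._* F) (sumℕ-cong (λ r → cong ℤ.∣_∣ (minor-column A j≢p r))) ⟩
    S ℕ.* F ∎)

-- The depth k(D)

x^1+n≤y^n⇒x≤y : ∀ {x y} n → 2 ℕ.≤ x → x ℕ.^ suc n ℕ.≤ y ℕ.^ n → x ℕ.≤ y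
x^1+n≤y^n⇒x≤y {x} {y} n 2≤x xⁿ⁺¹≤yⁿ with x ℕP.≤? y
... | yes x≤y = x≤y
... | no  x≰y = ⊥-elim (ℕP.<-irrefl refl (begin-strict
  y ℕ.^ n       ≤⟨ ℕP.^-monoˡ-≤ n (ℕP.<⇒≤ (ℕP.≰⇒> x≰y)) ⟩
  x ℕ.^ n       <⟨ ℕP.^-monoʳ-< x 2≤x (ℕP.n<1+n n) ⟩
  x ℕ.^ suc n   ≤⟨ xⁿ⁺¹≤yⁿ ⟩
  y ℕ.^ n       ∎))
  where open ℕP.≤-Reasoning

-- Admissible n D t  says  t ≤ log₂ log₂ D / log₂ (d/(d-1))  for d = n + 1, as in the definition of IsK.
Admissible : ℕ → ℕ → ℕ → Set
Admissible n D t = 2 ℕ.^ (suc n ℕ.^ t) ℕ.≤ D ℕ.^ (n ℕ.^ t)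

2≤2^[1+n]^t : ∀ n t → 2 ℕ.≤ 2 ℕ.^ (suc n ℕ.^ t)
2≤2^[1+n]^t n t = ℕP.^-monoʳ-≤ 2 (ℕP.m^n>0 (suc n) t)

admissible-pred : ∀ {n D} t → Admissible n D (suc t) → Admissible n D t
admissible-pred {n} {D} t adm = x^1+n≤y^n⇒x≤y n (2≤2^[1+n]^t n t) (subst₂ ℕ._≤_
  (trans (cong (2 ℕ.^_) (ℕP.*-comm (suc n) (suc n ℕ.^ t))) (sym (ℕP.^-*-assoc 2 (suc n ℕ.^ t) (suc n))))
  (trans (cong (D ℕ.^_) (ℕP.*-comm n (n ℕ.^ t))) (sym (ℕP.^-*-assoc D (n ℕ.^ t) n)))
  adm)

admissible-anti : ∀ {n D s t} → s ℕ.≤ t → Admissible n D t → Admissible n D s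
admissible-anti {t = zero}  z≤n adm = adm
admissible-anti {t = suc t} s≤1+t adm with ℕP.m≤n⇒m<n∨m≡n s≤1+t
... | inj₁ s<1+t = admissible-anti (ℕP.≤-pred s<1+t) (admissible-pred t adm)
... | inj₂ refl  = adm

admissible⇒<k : ∀ {n D k t} → IsK (suc n) D k → Admissible n D t → t ℕ.< k
admissible⇒<k {n} {t = t} (inj₁ (refl , refl)) adm = ⊥-elim (ℕP.<-irrefl refl
  (ℕP.≤-trans (2≤2^[1+n]^t n t) (ℕP.≤-trans adm (ℕP.≤-reflexive (ℕP.^-zeroˡ (n ℕ.^ t))))))
admissible⇒<k {t = t} (inj₂ (m , refl , _ , _ , not-admissible)) adm with t ℕP.≤? m
... | yes t≤m = s≤s t≤m
... | no  t≰m = ⊥-elim (ℕP.<⇒≱ not-admissible (admissible-anti (ℕP.≰⇒> t≰m) adm))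

-- The decomposition

powℚ-distrib-* : ∀ x y n → powℚ (x ℚ.* y) n ≡ powℚ x n ℚ.* powℚ y n
powℚ-distrib-* x y zero    = refl
powℚ-distrib-* x y (suc n) rewrite powℚ-distrib-* x y n =
  solve 4 (λ x y a b → (x :* y) :* (a :* b) := (x :* a) :* (y :* b)) refl x y (powℚ x n) (powℚ y n)
  where open ℚSolver.+-*-Solver

powℚ-toℚ : ∀ a n → powℚ (toℚ (+ a)) n ≡ toℚ (+ (a ℕ.^ n))
powℚ-toℚ a zero    = refl
powℚ-toℚ a (suc n) rewrite powℚ-toℚ a n =
  trans (sym (toℚ-homo-* (+ a) (+ (a ℕ.^ n)))) (cong toℚ (sym (ℤP.pos-* a (a ℕ.^ n))))

powℚ-nonNeg : ∀ {x} n → 0ℚ ℚ.≤ x → 0ℚ ℚ.≤ powℚ x n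
powℚ-nonNeg zero        0≤x = ℚP.nonNegative⁻¹ 1ℚ
powℚ-nonNeg {x} (suc n) 0≤x = ℚP.nonNegative⁻¹ _
  {{ℚP.nonNeg*nonNeg⇒nonNeg x {{ℚ.nonNegative 0≤x}} (powℚ x n) {{ℚ.nonNegative (powℚ-nonNeg n 0≤x)}}}}

1≤powℚ : ∀ {x} n → 1ℚ ℚ.≤ x → 1ℚ ℚ.≤ powℚ x n
1≤powℚ zero        1≤x = ℚP.≤-refl
1≤powℚ {x} (suc n) 1≤x = begin
  1ℚ               ≤⟨ 1≤x ⟩
  x                ≡⟨ sym (ℚP.*-identityʳ x) ⟩
  x ℚ.* 1ℚ         ≤⟨ ℚP.*-monoˡ-≤-nonNeg x {{0≤x}} (1≤powℚ n 1≤x) ⟩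
  x ℚ.* powℚ x n   ∎
  where
  open ℚP.≤-Reasoning
  0≤x = ℚ.nonNegative (ℚP.≤-trans (ℚP.nonNegative⁻¹ 1ℚ) 1≤x)

powℚ≤1⇒≤1 : ∀ {x} n → 0ℚ ℚ.≤ x → powℚ x (suc n) ℚ.≤ 1ℚ → x ℚ.≤ 1ℚ
powℚ≤1⇒≤1 {x} n 0≤x xⁿ⁺¹≤1 with x ℚP.≤? 1ℚ
... | yes x≤1 = x≤1
... | no  x≰1 = ⊥-elim (ℚP.<-irrefl refl (begin-strict
  1ℚ               <⟨ ℚP.≰⇒> x≰1 ⟩
  x                ≡⟨ sym (ℚP.*-identityʳ x) ⟩
  x ℚ.* 1ℚ         ≤⟨ ℚP.*-monoˡ-≤-nonNeg x {{ℚ.nonNegative 0≤x}} (1≤powℚ n (ℚP.<⇒≤ (ℚP.≰⇒> x≰1))) ⟩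
  powℚ x (suc n)   ≤⟨ xⁿ⁺¹≤1 ⟩
  1ℚ               ∎))
  where open ℚP.≤-Reasoning

≤1-scaled : ∀ {p} D → 0ℚ ℚ.≤ p → 1 ℕ.≤ D → p ℚ.* toℚ (+ D) ℚ.≤ 1ℚ → p ℚ.≤ 1ℚ
≤1-scaled {p} D 0≤p 1≤D pD≤1 = begin
  p                 ≡⟨ sym (ℚP.*-identityʳ p) ⟩
  p ℚ.* 1ℚ          ≤⟨ ℚP.*-monoˡ-≤-nonNeg p {{ℚ.nonNegative 0≤p}} (toℚ+-mono-≤ 1≤D) ⟩
  p ℚ.* toℚ (+ D)   ≤⟨ pD≤1 ⟩
  1ℚ                ∎
  where open ℚP.≤-Reasoning

∣combination∣≤ : ∀ {m} (B̄ : Mat m) (w : Fin m → ℤ) (α : Fin m → ℚ) E →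
  (∀ r → toℚ (w r) ≡ sumℚ (λ i → toℚ (B̄ r i) ℚ.* α i)) → (∀ i → ℚ.∣ α i ∣ ℚ.≤ 1ℚ) →
  (∀ r c → ℤ.∣ B̄ r c ∣ ℕ.≤ E) → ∀ r → ℤ.∣ w r ∣ ℕ.≤ m ℕ.* E
∣combination∣≤ {m} B̄ w α E w≡B̄α ∣α∣≤1 bounded r = toℚ+-cancel-≤ (begin
  toℚ (+ ℤ.∣ w r ∣)                         ≡⟨ sym (∣toℚ∣≡toℚ∣∣ (w r)) ⟩
  ℚ.∣ toℚ (w r) ∣                           ≡⟨ cong ℚ.∣_∣ (w≡B̄α r) ⟩
  ℚ.∣ sumℚ (λ i → toℚ (B̄ r i) ℚ.* α i) ∣    ≤⟨ ∣sumℚ∣≤ _ E term≤E ⟩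
  toℚ (+ (m ℕ.* E))                         ∎)
  where
  open ℚP.≤-Reasoning
  term≤E : ∀ i → ℚ.∣ toℚ (B̄ r i) ℚ.* α i ∣ ℚ.≤ toℚ (+ E)
  term≤E i = begin
    ℚ.∣ toℚ (B̄ r i) ℚ.* α i ∣
      ≡⟨ ℚP.∣p*q∣≡∣p∣*∣q∣ (toℚ (B̄ r i)) (α i) ⟩
    ℚ.∣ toℚ (B̄ r i) ∣ ℚ.* ℚ.∣ α i ∣
      ≤⟨ ℚP.*-monoˡ-≤-nonNeg ℚ.∣ toℚ (B̄ r i) ∣ {{ℚP.∣-∣-nonNeg (toℚ (B̄ r i))}} (∣α∣≤1 i) ⟩
    ℚ.∣ toℚ (B̄ r i) ∣ ℚ.* 1ℚ
      ≡⟨ trans (ℚP.*-identityʳ _) (∣toℚ∣≡toℚ∣∣ (B̄ r i)) ⟩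
    toℚ (+ ℤ.∣ B̄ r i ∣)
      ≤⟨ toℚ+-mono-≤ (bounded r i) ⟩
    toℚ (+ E) ∎

replaceCol-entries≤ : ∀ {m} (B̄ : Mat m) j w {E E'} → E ℕ.≤ E' →
  (∀ r c → ℤ.∣ B̄ r c ∣ ℕ.≤ E) → (∀ r → ℤ.∣ w r ∣ ℕ.≤ E') →
  ∀ r c → ℤ.∣ replaceCol B̄ j w r c ∣ ℕ.≤ E'
replaceCol-entries≤ B̄ j w E≤E' B̄≤E w≤E' r c with c ≟ j
... | yes _ = w≤E' r
... | no  _ = ℕP.≤-trans (B̄≤E r c) E≤E'

∣det∣-decay : ∀ n (N O : ℤ) a → toℚ N ≡ a ℚ.* toℚ O →
  powℚ ℚ.∣ a ∣ (suc n) ℚ.* toℚ (+ ℤ.∣ O ∣) ℚ.≤ 1ℚ → ℤ.∣ N ∣ ℕ.^ suc n ℕ.≤ ℤ.∣ O ∣ ℕ.^ n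
∣det∣-decay n N O a N≡aO aO≤1 = toℚ+-cancel-≤ (begin
  toℚ (+ (ℤ.∣ N ∣ ℕ.^ suc n))                 ≡⟨ sym (powℚ-toℚ ℤ.∣ N ∣ (suc n)) ⟩
  powℚ (toℚ (+ ℤ.∣ N ∣)) (suc n)              ≡⟨ cong (λ z → powℚ z (suc n)) ∣N∣≡∣a∣o ⟩
  powℚ (ℚ.∣ a ∣ ℚ.* o) (suc n)                ≡⟨ powℚ-distrib-* ℚ.∣ a ∣ o (suc n) ⟩
  powℚ ℚ.∣ a ∣ (suc n) ℚ.* (o ℚ.* powℚ o n)   ≡⟨ sym (ℚP.*-assoc (powℚ ℚ.∣ a ∣ (suc n)) o (powℚ o n)) ⟩
  (powℚ ℚ.∣ a ∣ (suc n) ℚ.* o) ℚ.* powℚ o n   ≤⟨ ℚP.*-monoʳ-≤-nonNeg (powℚ o n) {{0≤oⁿ}} aO≤1 ⟩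
  1ℚ ℚ.* powℚ o n                             ≡⟨ ℚP.*-identityˡ _ ⟩
  powℚ o n                                    ≡⟨ powℚ-toℚ ℤ.∣ O ∣ n ⟩
  toℚ (+ (ℤ.∣ O ∣ ℕ.^ n))                     ∎)
  where
  open ℚP.≤-Reasoning
  o = toℚ (+ ℤ.∣ O ∣)
  0≤oⁿ = ℚ.nonNegative (powℚ-nonNeg n (toℚ+-mono-≤ {0} {ℤ.∣ O ∣} z≤n))
  ∣N∣≡∣a∣o : toℚ (+ ℤ.∣ N ∣) ≡ ℚ.∣ a ∣ ℚ.* o
  ∣N∣≡∣a∣o = trans (sym (∣toℚ∣≡toℚ∣∣ N))
    (trans (cong ℚ.∣_∣ N≡aO) (trans (ℚP.∣p*q∣≡∣p∣*∣q∣ a (toℚ O)) (cong (ℚ.∣ a ∣ ℚ.*_) (∣toℚ∣≡toℚ∣∣ O))))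

^-decay-compose : ∀ n t N O D → N ℕ.^ suc n ℕ.≤ O ℕ.^ n → O ℕ.^ (suc n ℕ.^ t) ℕ.≤ D ℕ.^ (n ℕ.^ t) →
  N ℕ.^ (suc n ℕ.^ suc t) ℕ.≤ D ℕ.^ (n ℕ.^ suc t)
^-decay-compose n t N O D N≤O O≤D = begin
  N ℕ.^ (suc n ℕ.* suc n ℕ.^ t)     ≡⟨ sym (ℕP.^-*-assoc N (suc n) (suc n ℕ.^ t)) ⟩
  (N ℕ.^ suc n) ℕ.^ (suc n ℕ.^ t)   ≤⟨ ℕP.^-monoˡ-≤ (suc n ℕ.^ t) N≤O ⟩
  (O ℕ.^ n) ℕ.^ (suc n ℕ.^ t)       ≡⟨ ^-swap O n (suc n ℕ.^ t) ⟩
  (O ℕ.^ (suc n ℕ.^ t)) ℕ.^ n       ≤⟨ ℕP.^-monoˡ-≤ n O≤D ⟩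
  (D ℕ.^ (n ℕ.^ t)) ℕ.^ n           ≡⟨ ^-swap D (n ℕ.^ t) n ⟩
  (D ℕ.^ n) ℕ.^ (n ℕ.^ t)           ≡⟨ ℕP.^-*-assoc D n (n ℕ.^ t) ⟩
  D ℕ.^ (n ℕ.* n ℕ.^ t)             ∎
  where
  open ℕP.≤-Reasoning
  ^-swap : ∀ x a b → (x ℕ.^ a) ℕ.^ b ≡ (x ℕ.^ b) ℕ.^ a
  ^-swap x a b =
    trans (ℕP.^-*-assoc x a b) (trans (cong (x ℕ.^_) (ℕP.*-comm a b)) (sym (ℕP.^-*-assoc x b a)))

record DepthBound (n C D k : ℕ) (B̄ : Mat (suc n)) : Set where
  field
    depth     : ℕ
    depth≤k   : depth ℕ.≤ k
    entries≤  : ∀ r c → ℤ.∣ B̄ r c ∣ ℕ.≤ suc n ℕ.^ depth ℕ.* C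
    det-decay : ℤ.∣ det B̄ ∣ ℕ.^ (suc n ℕ.^ depth) ℕ.≤ D ℕ.^ (n ℕ.^ depth)

appears-depthBound : ∀ {n C D k} (B : Mat (suc n)) → D ≡ ℤ.∣ det B ∣ → (∀ r c → ℤ.∣ B r c ∣ ℕ.≤ C) →
  IsK (suc n) D k → ∀ {B̄} → Appears B B̄ → DepthBound n C D k B̄
appears-depthBound {C = C} B refl B≤C isK root = record
  { depth     = 0
  ; depth≤k   = z≤n
  ; entries≤  = λ r c → ℕP.≤-trans (B≤C r c) (ℕP.≤-reflexive (sym (ℕP.+-identityʳ C)))
  ; det-decay = ℕP.≤-refl
  }
appears-depthBound {n} {C} {D} B D≡ B≤C isK
    (step {B̄} appears 1<∣det∣ w (α , w≡B̄α , α-small) j _) = record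
  { depth     = suc t
  ; depth≤k   = admissible⇒<k isK (ℕP.≤-trans (ℕP.^-monoˡ-≤ (suc n ℕ.^ t) 1<∣det∣) det-decay)
  ; entries≤  = λ r c → subst (ℤ.∣ replaceCol B̄ j w r c ∣ ℕ.≤_) (sym (ℕP.*-assoc (suc n) (suc n ℕ.^ t) C))
                  (replaceCol-entries≤ B̄ j w (ℕP.m≤n*m E (suc n)) entries≤
                    (∣combination∣≤ B̄ w α E w≡B̄α ∣α∣≤1 entries≤) r c)
  ; det-decay = ^-decay-compose n t ℤ.∣ det (replaceCol B̄ j w) ∣ ℤ.∣ det B̄ ∣ D
                  (∣det∣-decay n (det (replaceCol B̄ j w)) (det B̄) (α j)
                    (toℚ-det-replaceCol B̄ j w α w≡B̄α) (α-small j))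
                  det-decay
  }
  where
  open DepthBound (appears-depthBound B D≡ B≤C isK appears) renaming (depth to t)
  E : ℕ
  E = suc n ℕ.^ t ℕ.* C
  ∣α∣≤1 : ∀ i → ℚ.∣ α i ∣ ℚ.≤ 1ℚ
  ∣α∣≤1 i = powℚ≤1⇒≤1 n (ℚP.0≤∣p∣ (α i))
    (≤1-scaled ℤ.∣ det B̄ ∣ (powℚ-nonNeg (suc n) (ℚP.0≤∣p∣ (α i))) (ℕP.<⇒≤ 1<∣det∣) (α-small i))

-- Entries of det B̄ · B̄⁻¹

unit : ∀ {n} → Fin n → Fin n → ℤ
unit j r = if does (r ≟ j) then + 1 else + 0

toℚ-unit : ∀ {n} (j r : Fin n) → toℚ (unit j r) ≡ (if does (r ≟ j) then 1ℚ else 0ℚ)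
toℚ-unit j r with does (r ≟ j)
... | true  = refl
... | false = refl

sumℕ-∣unit∣≤1 : ∀ {n} (j : Fin (suc n)) → sumℕ (λ r → ℤ.∣ unit j r ∣) ℕ.≤ 1
sumℕ-∣unit∣≤1 {n} j = ℕP.≤-trans
  (sumℕ-≤-except (λ r → ℤ.∣ unit j r ∣) j 1 0
    (ℕP.≤-reflexive (cong (λ b → ℤ.∣ if b then + 1 else + 0 ∣) (dec-true (j ≟ j) refl)))
    (λ r r≢j → ℕP.≤-reflexive (cong (λ b → ℤ.∣ if b then + 1 else + 0 ∣) (dec-false (r ≟ j) r≢j))))
  (ℕP.≤-reflexive (cong suc (ℕP.*-zeroʳ n)))

∣det*inverse∣≤ : ∀ n (B̄ : Mat (suc n)) (M : QMat (suc n)) E →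
  (∀ i j → sumℚ (λ l → toℚ (B̄ i l) ℚ.* M l j) ≡ (if does (i ≟ j) then 1ℚ else 0ℚ)) →
  (∀ r c → ℤ.∣ B̄ r c ∣ ℕ.≤ E) →
  ∀ i j → ℚ.∣ toℚ (det B̄) ℚ.* M i j ∣ ℚ.≤ toℚ (+ ((n !) ℕ.* E ℕ.^ n))
∣det*inverse∣≤ n B̄ M E inverse B̄≤E i j = begin
  ℚ.∣ toℚ (det B̄) ℚ.* M i j ∣   ≡⟨ cong ℚ.∣_∣ (trans (ℚP.*-comm (toℚ (det B̄)) (M i j)) (sym det-X)) ⟩
  ℚ.∣ toℚ (det X) ∣             ≡⟨ ∣toℚ∣≡toℚ∣∣ (det X) ⟩
  toℚ (+ ℤ.∣ det X ∣)            ≤⟨ toℚ+-mono-≤ ∣det-X∣≤ ⟩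
  toℚ (+ ((n !) ℕ.* E ℕ.^ n))    ∎
  where
  open ℚP.≤-Reasoning
  X : Mat (suc n)
  X = replaceCol B̄ i (unit j)
  det-X : toℚ (det X) ≡ M i j ℚ.* toℚ (det B̄)
  det-X = toℚ-det-replaceCol B̄ i (unit j) (λ l → M l j) (λ r → trans (toℚ-unit j r) (sym (inverse r j)))
  ∣det-X∣≤ : ℤ.∣ det X ∣ ℕ.≤ (n !) ℕ.* E ℕ.^ n
  ∣det-X∣≤ = ℕP.≤-trans
    (∣det∣≤column-norm n X i E (λ r c c≢i →
      ℕP.≤-trans (ℕP.≤-reflexive (cong ℤ.∣_∣ (replaceCol-off B̄ i (unit j) r c c≢i))) (B̄≤E r c)))
    (ℕP.≤-trans
      (ℕP.*-monoˡ-≤ _ (ℕP.≤-trans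
        (ℕP.≤-reflexive (sumℕ-cong (λ r → cong ℤ.∣_∣ (replaceCol-at B̄ i (unit j) r))))
        (sumℕ-∣unit∣≤1 j)))
      (ℕP.≤-reflexive (ℕP.*-identityˡ _)))

corollary4p4 : (d : ℕ) → 2 ℕ.≤ d → (B : Mat d) → (D : ℕ) → D ≡ ℤ.∣ det B ∣ → 1 ℕ.≤ D →
  (C : ℕ) → (∀ i j → ℤ.∣ B i j ∣ ℕ.≤ C) →
  (k : ℕ) → IsK d D k →
  (B̄ : Mat d) → Appears B B̄ →
  (M : QMat d) → (∀ i j → sumℚ (λ l → toℚ (B̄ i l) ℚ.* M l j) ≡ (if does (i ≟ j) then ℚ.1ℚ else ℚ.0ℚ)) →
  ∀ i j → ℚ.∣ toℚ (det B̄) ℚ.* M i j ∣ ℚ.≤ toℚ (+ (((d ℕ.∸ 1) !) ℕ.* ((d ℕ.^ k) ℕ.* C) ℕ.^ (d ℕ.∸ 1)))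
corollary4p4 (suc n) (s≤s _) B D D≡ _ C B≤C k isK B̄ appears M inverse =
  ∣det*inverse∣≤ n B̄ M (suc n ℕ.^ k ℕ.* C) inverse
    (λ r c → ℕP.≤-trans (entries≤ r c) (ℕP.*-monoˡ-≤ C (ℕP.^-monoʳ-≤ (suc n) depth≤k)))
  where open DepthBound (appears-depthBound B D≡ B≤C isK appears)
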